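{- Let $X\subset\mathbb{Z}_7$ and let $d,d'$ be integers with $\nu(d)=\nu(d')=0$ and $r(d')=2r(d)$. There is $\lambda\in\Lambda_h$ for some $h<m$ such that $\tilde e(\lambda d,\lambda d')\notin X$ whenever one of the following holds: (i) $\nu(2d-d')<m$ and $\ell(X)\le 4$; or (ii) $\nu(2d-d')=m$ and $r(2d-d')\notin X\cap(X+1)$.
   Context: Fix an integer $m\ge 2$ and $N=7^{m+1}$. For a nonzero integer $x$, $\nu(x)$ is the largest $k$ with $7^k\mid x$, and $r(x)$ is the residue modulo $7$ of $x/7^{\nu(x)}$. For an integer $x$ (or element of $\mathbb{Z}_N$, via any representative), $q(x)\in\mathbb{Z}_7$ is the residue modulo $7$ of $\lfloor x/7^m\rfloor$. For $0\le h\le m-1$, $\Lambda_h=\{1+7^{m-h}k:0\le k\le6\}\subset\mathbb{Z}_N$. For $\lambda\in\mathbb{Z}_N$ and integers $d,d'$ with $r(d')=2r(d)$, $\tilde e(\lambda d,\lambda d')=2q(\lambda d)-q(\lambda d')\in\mathbb{Z}_7$. For $Y\subset\mathbb{Z}_7$, $\ell(Y)$ is the least $L\ge0$ with $Y\subseteq\{a,a+1,\dots,a+L-1\}$ (mod 7) for some $a$, and $X+1=\{x+1:x\in X\}$. -}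

module Defs where

open import Data.Nat as ℕ using (ℕ; zero; suc; _^_)
open import Data.Nat.DivMod using (_mod_)
open import Data.Integer as ℤ using (ℤ; +_)
open import Data.Integer.DivMod using (_/ℕ_; _%ℕ_)
open import Data.Integer.Divisibility using (_∣_)
open import Data.Fin using (Fin; toℕ)
open import Data.Fin.Subset using (Subset)
open import Data.Vec using (tabulate; lookup)
open import Data.Bool using (Bool; true; false; _∧_; _∨_; if_then_else_)
open import Data.List using (List)
open import Data.Bool.ListAction using (all; any)
open import Data.Nat.Properties using (m^n≢0)
open import Data.List using () renaming (allFin to allFinL)
open import Data.Product using (Σ; _×_)
open import Relation.Nullary using (¬_)

ℤ₇ : Set
ℤ₇ = Fin 7

mod7 : ℤ → ℤ₇
mod7 x = (x %ℕ 7) mod 7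

_⊕_ : ℤ₇ → ℤ₇ → ℤ₇
a ⊕ b = (toℕ a ℕ.+ toℕ b) mod 7

_⊖_ : ℤ₇ → ℤ₇ → ℤ₇
a ⊖ b = (toℕ a ℕ.+ (7 ℕ.∸ toℕ b)) mod 7

two·_ : ℤ₇ → ℤ₇
two· a = a ⊕ a

one : ℤ₇
one = mod7 (+ 1)

-- ν(x) = k : 7^k divides x but 7^(k+1) does not (never holds for x = 0)
ν≡ : ℤ → ℕ → Set
ν≡ x k = (+ (7 ^ k) ∣ x) × ¬ (+ (7 ^ suc k) ∣ x)

-- r(x) for x with ν(x) = k : residue mod 7 of x / 7^k
r : ℤ → ℕ → ℤ₇
r x k = mod7 ((x /ℕ (7 ^ k)) {{m^n≢0 7 k}})

-- q(x) = ⌊x / 7^m⌋ mod 7  (well defined on ℤ_N, N = 7^(m+1))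
q : ℕ → ℤ → ℤ₇
q m x = mod7 ((x /ℕ (7 ^ m)) {{m^n≢0 7 m}})

-- the element 1 + 7^(m-h) k of Λ_h (as an integer representative)
Λelt : ℕ → ℕ → Fin 7 → ℤ
Λelt m h k = + 1 ℤ.+ + (7 ^ (m ℕ.∸ h)) ℤ.* + (toℕ k)

ẽ : ℕ → ℤ → ℤ → ℤ₇
ẽ m a b = (two· (q m a)) ⊖ (q m b)

_+1 : Subset 7 → Subset 7
X +1 = tabulate (λ y → lookup X (y ⊖ one))

interval : ℤ₇ → ℕ → Subset 7
interval a L = tabulate (λ y → toℕ (y ⊖ a) ℕ.<ᵇ L)

fits : Subset 7 → ℕ → Bool
fits X L = any (λ a → all (λ y → if lookup X y then lookup (interval a L) y else true)
                          (allFinL 7))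
               (allFinL 7)

ellFrom : ℕ → ℕ → Subset 7 → ℕ
ellFrom L zero    X = L
ellFrom L (suc f) X = if fits X L then L else ellFrom (suc L) f X

-- ℓ(X): least L ≥ 0 with X ⊆ {a,…,a+L-1} for some a (L = 7 always works)
ℓ : Subset 7 → ℕ
ℓ X = ellFrom 0 7 X

module Submission where

-- Write M = 7^m and split an integer x into base-M digits,
-- x = lo x + hi x · M with 0 ≤ lo x < M, so that q(x) = hi x mod 7.
-- For x = λd, y = λd' we have 2x − y = λD with D = 2d − d', and comparing
-- the digits of x, y and λD shows that ẽ(x, y) = q(λD) + z where the carry z
-- satisfies z·M = lo(λD) + lo y − 2 lo x; in particular z ∈ {−1, 0, 1}.
--  (i)  If ν(D) = j < m, then λ = 1 + 7^(m−j)k shifts hi(λD) by k·(D/7^j), a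
--       unit mod 7, so q(λD) can be made equal to any residue t.  Taking t in
--       the middle of three consecutive residues outside X (they exist since
--       ℓ(X) ≤ 4) gives ẽ ∈ {t − 1, t, t + 1}, disjoint from X.
--  (ii) If ν(D) = m, then q(λD) = r(D) for λ ∈ Λ₁, and lo(λD) = 0, so the
--       carry is decided by lo x alone.  Choosing k so that the digit of
--       λd at position m − 1 is 0 (resp. 6) forces ẽ = r(D) (resp. r(D) − 1);
--       one of them lies outside X because r(D) ∉ X ∩ (X + 1).

open import Defs
open import Data.Nat using (ℕ; _≤_; _<_)
open import Data.Integer using (ℤ; _-_; _*_; +_)
open import Data.Fin using (Fin)
open import Data.Fin.Subset using (Subset; _∈_; _∉_; _∩_)
open import Data.Product using (Σ; _×_; ∃-syntax)
open import Data.Sum using (_⊎_)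
open import Relation.Binary.PropositionalEquality using (_≡_)

import Data.Nat as N
import Data.Nat.Properties as NP
import Data.Nat.DivMod as ND
import Data.Integer as Z
import Data.Integer.Properties as ZP
import Data.Integer.DivMod as ZD
import Data.Integer.Divisibility.Signed as ZS
import Data.Fin as F
import Data.Fin.Properties as FP
import Data.Vec.Properties as VP
open import Data.Integer using (-[1+_]; -_)
open import Data.Integer.Tactic.RingSolver using (solve-∀)
open import Data.Fin.Subset.Properties using (_∈?_; anySubset?; x∈p∩q⁺)
open import Data.Vec using (lookup)
open import Data.Product using (_,_; proj₁; proj₂)
open import Data.Sum using (inj₁; inj₂)
open import Data.Empty using (⊥-elim)
open import Relation.Nullary using (¬?; Dec; yes; no)
open import Relation.Nullary.Decidable using (from-yes; from-no; _→-dec_; _×-dec_; decidable-stable)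
open import Relation.Binary.PropositionalEquality
  using (_≢_; refl; sym; trans; cong; cong₂; subst; subst₂; module ≡-Reasoning)

infix 4 _≈_mod_
record _≈_mod_ (a b n : ℤ) : Set where
  constructor congruent
  field
    multiple : ℤ
    equation : a ≡ b Z.+ multiple * n

≈-refl : ∀ {a n} → a ≈ a mod n
≈-refl {a} {n} = congruent (+ 0) (sym (trans (cong (Z._+_ a) (ZP.*-zeroˡ n)) (ZP.+-identityʳ a)))

≈-+ : ∀ {a b a' b' n} → a ≈ b mod n → a' ≈ b' mod n → a Z.+ a' ≈ b Z.+ b' mod n
≈-+ {b = b} {b' = b'} {n} (congruent c p) (congruent c' p') =
  congruent (c Z.+ c') (trans (cong₂ Z._+_ p p') (regroup b c b' c' n))
  where
  regroup : ∀ b c b' c' n → (b Z.+ c * n) Z.+ (b' Z.+ c' * n) ≡ (b Z.+ b') Z.+ (c Z.+ c') * n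
  regroup = solve-∀

≈-neg : ∀ {a b n} → a ≈ b mod n → - a ≈ - b mod n
≈-neg {b = b} {n = n} (congruent c p) = congruent (- c) (trans (cong -_ p) (negate b c n))
  where
  negate : ∀ b c n → - (b Z.+ c * n) ≡ - b Z.+ (- c) * n
  negate = solve-∀

≈-* : ∀ {a b a' b' n} → a ≈ b mod n → a' ≈ b' mod n → a * a' ≈ b * b' mod n
≈-* {b = b} {b' = b'} {n} (congruent c p) (congruent c' p') =
  congruent (c * b' Z.+ b * c' Z.+ c * c' * n) (trans (cong₂ _*_ p p') (expand b c b' c' n))
  where
  expand : ∀ b c b' c' n →
    (b Z.+ c * n) * (b' Z.+ c' * n) ≡ b * b' Z.+ (c * b' Z.+ b * c' Z.+ c * c' * n) * n
  expand = solve-∀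

Carry : ℤ → Set
Carry z = z ≡ -[1+ 0 ] ⊎ z ≡ + 0 ⊎ z ≡ + 1

inside-±1 : ∀ z → - (+ 1) Z.< z → z Z.< + 1 → z ≡ + 0
inside-±1 (+ 0)           _          _                   = refl
inside-±1 (+ N.suc n)     _          (Z.+<+ (N.s≤s ()))
inside-±1 -[1+ n ]        (Z.-<- ()) _

inside-±2 : ∀ z → - (+ 2) Z.< z → z Z.< + 2 → Carry z
inside-±2 (+ 0)               _                   _                           = inj₂ (inj₁ refl)
inside-±2 (+ 1)               _                   _                           = inj₂ (inj₂ refl)
inside-±2 (+ N.suc (N.suc n)) _                   (Z.+<+ (N.s≤s (N.s≤s ())))
inside-±2 -[1+ 0 ]            _                   _                           = inj₁ refl
inside-±2 -[1+ N.suc n ]      (Z.-<- (N.s≤s ()))  _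

inside-−2-0 : ∀ z → - (+ 2) Z.< z → z Z.< + 0 → z ≡ -[1+ 0 ]
inside-−2-0 (+ n)              _                  (Z.+<+ ())
inside-−2-0 -[1+ 0 ]           _                  _          = refl
inside-−2-0 -[1+ N.suc n ]     (Z.-<- (N.s≤s ())) _

module Digits (M : ℕ) .{{_ : N.NonZero M}} where

  hi : ℤ → ℤ
  hi x = x ZD./ℕ M

  lo : ℤ → ℕ
  lo x = x ZD.%ℕ M

  digits : ∀ x → x ≡ + lo x Z.+ hi x * + M
  digits x = ZD.a≡a%ℕn+[a/ℕn]*n x M

  lo<M : ∀ x → lo x < M
  lo<M x = ZD.n%ℕd<d x M

  multiple-< : ∀ {z a b} k → z * + M Z.+ + a ≡ + b → b < a N.+ k N.* M → z Z.< + k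
  multiple-< {z} {a} {b} k eq b<a+kM with z Z.<? + k
  ... | yes z<k = z<k
  ... | no z≮k = ⊥-elim (NP.<⇒≱ b<a+kM (ZP.drop‿+≤+ a+kM≤b))
    where
    open ZP.≤-Reasoning
    a+kM≤b : + (a N.+ k N.* M) Z.≤ + b
    a+kM≤b = begin
      + (a N.+ k N.* M)     ≡⟨ trans (ZP.pos-+ a (k N.* M)) (cong (Z._+_ (+ a)) (ZP.pos-* k M)) ⟩
      + a Z.+ + k * + M     ≤⟨ ZP.+-monoʳ-≤ (+ a) (ZP.*-monoʳ-≤-nonNeg (+ M) (ZP.≮⇒≥ z≮k)) ⟩
      + a Z.+ z * + M       ≡⟨ trans (ZP.+-comm (+ a) (z * + M)) eq ⟩
      + b                   ∎

  multiple-> : ∀ {z a b} k → z * + M Z.+ + a ≡ + b → a < b N.+ k N.* M → - (+ k) Z.< z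
  multiple-> {z} {a} {b} k eq a<b+kM =
    subst (- (+ k) Z.<_) (ZP.neg-involutive z) (ZP.neg-mono-< (multiple-< k negated a<b+kM))
    where
    cancel : ∀ z M a → (- z) * M Z.+ (z * M Z.+ a) ≡ a
    cancel = solve-∀
    negated : (- z) * + M Z.+ + b ≡ + a
    negated = trans (cong (λ w → (- z) * + M Z.+ w) (sym eq)) (cancel z (+ M) (+ a))

  no-carry : ∀ {z a b} → z * + M Z.+ + a ≡ + b → a < b N.+ M → b < a N.+ M → z ≡ + 0
  no-carry {a = a} {b} eq a<b+M b<a+M = inside-±1 _
    (multiple-> 1 eq (subst (λ w → a < b N.+ w) (sym (NP.*-identityˡ M)) a<b+M))
    (multiple-< 1 eq (subst (λ w → b < a N.+ w) (sym (NP.*-identityˡ M)) b<a+M))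

  two-digits< : ∀ {u v} w → u < M → v < M → u N.+ v < w N.+ 2 N.* M
  two-digits< w u<M v<M =
    NP.<-≤-trans (NP.+-mono-< u<M (subst (_ <_) (sym (NP.+-identityʳ M)) v<M)) (NP.m≤n+m (2 N.* M) w)

  digit-sum-carry : ∀ {z a a' b b'} → z * + M Z.+ + (a N.+ a') ≡ + (b N.+ b') →
    a < M → a' < M → b < M → b' < M → Carry z
  digit-sum-carry {a = a} {a'} {b} {b'} eq a<M a'<M b<M b'<M =
    inside-±2 _ (multiple-> 2 eq (two-digits< (b N.+ b') a<M a'<M))
                (multiple-< 2 eq (two-digits< (a N.+ a') b<M b'<M))

  borrow : ∀ {z a b} → z * + M Z.+ + a ≡ + b → b < a → a < b N.+ 2 N.* M → z ≡ -[1+ 0 ]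
  borrow {a = a} eq b<a a<b+2M = inside-−2-0 _ (multiple-> 2 eq a<b+2M)
    (multiple-< 0 eq (subst (_ <_) (sym (NP.+-identityʳ a)) b<a))

  digits-unique : ∀ {x u a} → x ≡ + u Z.+ a * + M → u < M → hi x ≡ a × lo x ≡ u
  digits-unique {x} {u} {a} x≡ u<M = ZP.i-j≡0⇒i≡j (hi x) a z≡0 , ZP.+-injective lo≡u
    where
    difference : ∀ x u a v b → x ≡ u Z.+ a * + M → x ≡ v Z.+ b * + M → (b - a) * + M Z.+ v ≡ u
    difference x u a v b p q = trans (rearrange u a v b (+ M)) (trans (cong (Z._- a * + M) (trans (sym q) p)) (cancel u a (+ M)))
      where
      rearrange : ∀ u a v b M → (b - a) * M Z.+ v ≡ (v Z.+ b * M) - a * M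
      rearrange = solve-∀
      cancel : ∀ u a M → (u Z.+ a * M) - a * M ≡ u
      cancel = solve-∀
    eq : (hi x - a) * + M Z.+ + lo x ≡ + u
    eq = difference x (+ u) a (+ lo x) (hi x) x≡ (digits x)
    z≡0 : hi x - a ≡ + 0
    z≡0 = no-carry eq (NP.<-≤-trans (lo<M x) (NP.m≤n+m M u)) (NP.<-≤-trans u<M (NP.m≤n+m M (lo x)))
    lo≡u : + lo x ≡ + u
    lo≡u = trans (sym (ZP.+-identityˡ (+ lo x))) (trans (cong (λ w → w * + M Z.+ + lo x) (sym z≡0)) eq)

  digits-shift : ∀ x c → hi (x Z.+ c * + M) ≡ hi x Z.+ c × lo (x Z.+ c * + M) ≡ lo x
  digits-shift x c = digits-unique (trans (cong (Z._+ c * + M) (digits x)) (regroup (+ lo x) (hi x) c (+ M))) (lo<M x)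
    where
    regroup : ∀ u h c M → (u Z.+ h * M) Z.+ c * M ≡ u Z.+ (h Z.+ c) * M
    regroup = solve-∀

  carry : ∀ x y D → + 2 * x - y ≡ D →
    (hi x Z.+ hi x - hi y - hi D) * + M Z.+ + (lo x N.+ lo x) ≡ + (lo D N.+ lo y)
  carry x y D D≡ = begin
    (hi x Z.+ hi x - hi y - hi D) * + M Z.+ + (lo x N.+ lo x)
      ≡⟨ cong (Z._+_ ((hi x Z.+ hi x - hi y - hi D) * + M)) (ZP.pos-+ (lo x) (lo x)) ⟩
    (hi x Z.+ hi x - hi y - hi D) * + M Z.+ (+ lo x Z.+ + lo x)
      ≡⟨ expand (hi x) (hi y) (hi D) (+ lo x) (+ lo y) (+ M) ⟩
    (+ 2 * (+ lo x Z.+ hi x * + M) - (+ lo y Z.+ hi y * + M)) - hi D * + M Z.+ + lo y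
      ≡⟨ cong₂ (λ s t → (+ 2 * s - t) - hi D * + M Z.+ + lo y) (sym (digits x)) (sym (digits y)) ⟩
    (+ 2 * x - y) - hi D * + M Z.+ + lo y
      ≡⟨ cong (λ s → s - hi D * + M Z.+ + lo y) (trans D≡ (digits D)) ⟩
    (+ lo D Z.+ hi D * + M) - hi D * + M Z.+ + lo y
      ≡⟨ cancel (+ lo D) (hi D) (+ M) (+ lo y) ⟩
    + lo D Z.+ + lo y
      ≡⟨ sym (ZP.pos-+ (lo D) (lo y)) ⟩
    + (lo D N.+ lo y) ∎
    where
    open ≡-Reasoning
    expand : ∀ a b c u v M → (a Z.+ a - b - c) * M Z.+ (u Z.+ u) ≡ (+ 2 * (u Z.+ a * M) - (v Z.+ b * M)) - c * M Z.+ v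
    expand = solve-∀
    cancel : ∀ u c M v → (u Z.+ c * M) - c * M Z.+ v ≡ u Z.+ v
    cancel = solve-∀

⟦_⟧ : ℤ₇ → ℤ
⟦ f ⟧ = + F.toℕ f

_⊗_ : ℤ₇ → ℤ₇ → ℤ₇
a ⊗ b = (F.toℕ a N.* F.toℕ b) ND.mod 7

module Base7 = Digits 7

toℕ-mod7 : ∀ a → F.toℕ (mod7 a) ≡ Base7.lo a
toℕ-mod7 a = trans (FP.toℕ-fromℕ< _) (ND.m<n⇒m%n≡m (Base7.lo<M a))

mod7-nat : ∀ n → mod7 (+ n) ≡ n ND.mod 7
mod7-nat n = FP.toℕ-injective (trans (toℕ-mod7 (+ n)) (sym (FP.toℕ-fromℕ< _)))

mod7-⟦⟧ : ∀ f → mod7 ⟦ f ⟧ ≡ f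
mod7-⟦⟧ f = FP.toℕ-injective (trans (toℕ-mod7 ⟦ f ⟧) (ND.m<n⇒m%n≡m (FP.toℕ<n f)))

mod7-rep : ∀ a → a ≈ ⟦ mod7 a ⟧ mod + 7
mod7-rep a = congruent (Base7.hi a) (trans (Base7.digits a) (cong (λ u → + u Z.+ Base7.hi a * + 7) (sym (toℕ-mod7 a))))

mod7-cong : ∀ {a b} → a ≈ b mod + 7 → mod7 a ≡ mod7 b
mod7-cong {b = b} (congruent c a≡) =
  trans (cong (λ x → Base7.lo x ND.mod 7) a≡) (cong (ND._mod 7) (proj₂ (Base7.digits-shift b c)))

mod7-+ : ∀ a b → mod7 (a Z.+ b) ≡ mod7 a ⊕ mod7 b
mod7-+ a b = begin
  mod7 (a Z.+ b)                                 ≡⟨ mod7-cong (≈-+ (mod7-rep a) (mod7-rep b)) ⟩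
  mod7 (⟦ mod7 a ⟧ Z.+ ⟦ mod7 b ⟧)                ≡⟨ cong mod7 (sym (ZP.pos-+ (F.toℕ (mod7 a)) (F.toℕ (mod7 b)))) ⟩
  mod7 (+ (F.toℕ (mod7 a) N.+ F.toℕ (mod7 b)))   ≡⟨ mod7-nat (F.toℕ (mod7 a) N.+ F.toℕ (mod7 b)) ⟩
  mod7 a ⊕ mod7 b                                ∎
  where open ≡-Reasoning

mod7-- : ∀ a b → mod7 (a - b) ≡ mod7 a ⊖ mod7 b
mod7-- a b = begin
  mod7 (a - b)                                        ≡⟨ mod7-cong (≈-+ (mod7-rep a) (≈-neg (mod7-rep b))) ⟩
  mod7 (⟦ f ⟧ - ⟦ g ⟧)                                 ≡⟨ mod7-cong {b = + (F.toℕ f N.+ (7 N.∸ F.toℕ g))} (congruent (- (+ 1)) wrap) ⟩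
  mod7 (+ (F.toℕ f N.+ (7 N.∸ F.toℕ g)))               ≡⟨ mod7-nat (F.toℕ f N.+ (7 N.∸ F.toℕ g)) ⟩
  f ⊖ g                                               ∎
  where
  open ≡-Reasoning
  f = mod7 a
  g = mod7 b
  complement : + (7 N.∸ F.toℕ g) Z.+ ⟦ g ⟧ ≡ + 7
  complement = trans (sym (ZP.pos-+ (7 N.∸ F.toℕ g) (F.toℕ g))) (cong +_ (NP.m∸n+n≡m (NP.<⇒≤ (FP.toℕ<n g))))
  subtract : ∀ u v w → u - v ≡ (u Z.+ w) Z.+ (- (+ 1)) * (w Z.+ v)
  subtract = solve-∀
  wrap : ⟦ f ⟧ - ⟦ g ⟧ ≡ + (F.toℕ f N.+ (7 N.∸ F.toℕ g)) Z.+ (- (+ 1)) * + 7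
  wrap = trans (subtract ⟦ f ⟧ ⟦ g ⟧ (+ (7 N.∸ F.toℕ g)))
    (cong₂ (λ s t → s Z.+ (- (+ 1)) * t) (sym (ZP.pos-+ (F.toℕ f) _)) complement)

mod7-* : ∀ a b → mod7 (a * b) ≡ mod7 a ⊗ mod7 b
mod7-* a b = begin
  mod7 (a * b)                                   ≡⟨ mod7-cong (≈-* (mod7-rep a) (mod7-rep b)) ⟩
  mod7 (⟦ mod7 a ⟧ * ⟦ mod7 b ⟧)                  ≡⟨ cong mod7 (sym (ZP.pos-* (F.toℕ (mod7 a)) (F.toℕ (mod7 b)))) ⟩
  mod7 (+ (F.toℕ (mod7 a) N.* F.toℕ (mod7 b)))   ≡⟨ mod7-nat (F.toℕ (mod7 a) N.* F.toℕ (mod7 b)) ⟩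
  mod7 a ⊗ mod7 b                                ∎
  where open ≡-Reasoning

Near : ℤ₇ → ℤ₇ → Set
Near t f = f ≡ t ⊖ one ⊎ f ≡ t ⊎ f ≡ t ⊕ one

carry-step : ∀ w z → Carry z → Near (mod7 w) (mod7 (w Z.+ z))
carry-step w _ (inj₁ refl)        = inj₁ (mod7-- w (+ 1))
carry-step w _ (inj₂ (inj₁ refl)) = inj₂ (inj₁ (cong mod7 (ZP.+-identityʳ w)))
carry-step w _ (inj₂ (inj₂ refl)) = inj₂ (inj₂ (mod7-+ w (+ 1)))

-- Over the field ℤ₇ every equation c + k·e = t with e ≠ 0 has a solution k
-- (checked by enumerating all residues; opaque, so that the enumeration is
-- not re-run whenever a solution is used).
opaque
  affine-solvable : ∀ c e t → e ≢ F.zero → ∃[ k ] (c ⊕ (k ⊗ e) ≡ t)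
  affine-solvable = from-yes (FP.all? λ c → FP.all? λ e → FP.all? λ t →
    ¬? (e FP.≟ F.zero) →-dec FP.any? λ k → c ⊕ (k ⊗ e) FP.≟ t)

choose-multiplier : ∀ c e g → mod7 e ≢ F.zero → ∃[ k ] (c Z.+ ⟦ k ⟧ * e ≈ ⟦ g ⟧ mod + 7)
choose-multiplier c e g e-unit = k , subst (λ f → c Z.+ ⟦ k ⟧ * e ≈ ⟦ f ⟧ mod + 7) hits (mod7-rep _)
  where
  solution = affine-solvable (mod7 c) (mod7 e) g e-unit
  k = proj₁ solution
  hits : mod7 (c Z.+ ⟦ k ⟧ * e) ≡ g
  hits = begin
    mod7 (c Z.+ ⟦ k ⟧ * e)             ≡⟨ mod7-+ c (⟦ k ⟧ * e) ⟩
    mod7 c ⊕ mod7 (⟦ k ⟧ * e)          ≡⟨ cong (mod7 c ⊕_) (trans (mod7-* ⟦ k ⟧ e) (cong (_⊗ mod7 e) (mod7-⟦⟧ k))) ⟩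
    mod7 c ⊕ (k ⊗ mod7 e)              ≡⟨ proj₂ solution ⟩
    g                                  ∎
    where open ≡-Reasoning

GapAround : Subset 7 → ℤ₇ → Set
GapAround X t = (t ⊖ one) ∉ X × t ∉ X × (t ⊕ one) ∉ X

opaque
  gap-of-three : ∀ X → ℓ X ≤ 4 → ∃[ t ] GapAround X t
  gap-of-three X = decidable-stable (claim? X) λ fails → from-no (anySubset? λ Y → ¬? (claim? Y)) (X , fails)
    where
    claim? : ∀ Y → Dec (ℓ Y ≤ 4 → ∃[ t ] GapAround Y t)
    claim? Y = ℓ Y NP.≤? 4 →-dec FP.any? λ t →
      ¬? ((t ⊖ one) ∈? Y) ×-dec ¬? (t ∈? Y) ×-dec ¬? ((t ⊕ one) ∈? Y)

near-∉ : ∀ {X t f} → GapAround X t → Near t f → f ∉ X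
near-∉ (t-1∉X , _ , _) (inj₁ refl)        = t-1∉X
near-∉ (_ , t∉X , _)   (inj₂ (inj₁ refl)) = t∉X
near-∉ (_ , _ , t+1∉X) (inj₂ (inj₂ refl)) = t+1∉X

predecessor-∉ : ∀ {X r} → r ∉ X ∩ (X +1) → r ∈ X → (r ⊖ one) ∉ X
predecessor-∉ {X} {r} r∉ r∈X r-1∈X = r∉ (x∈p∩q⁺ (r∈X , r∈X+1))
  where
  r∈X+1 : r ∈ X +1
  r∈X+1 = VP.lookup⇒[]= r (X +1)
    (trans (VP.lookup∘tabulate (λ y → lookup X (y ⊖ one)) r) (VP.[]=⇒lookup r-1∈X))

unit-part : ∀ x j → ν≡ x j → ∃[ e ] (x ≡ e * + (7 N.^ j) × mod7 e ≢ F.zero)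
unit-part x j (7^j∣x , 7^j+1∤x) = e , x≡ , e-unit
  where
  open ZS._∣_ (ZS.∣ᵤ⇒∣ {+ (7 N.^ j)} {x} 7^j∣x) renaming (quotient to e; equality to x≡)
  regroup : ∀ c s t → (+ 0 Z.+ c * s) * t ≡ c * (s * t)
  regroup = solve-∀
  e-unit : mod7 e ≢ F.zero
  e-unit e≡0 with subst (λ f → e ≈ ⟦ f ⟧ mod + 7) e≡0 (mod7-rep e)
  ... | congruent c e≡7c = 7^j+1∤x (ZS.∣⇒∣ᵤ (ZS.divides c (begin
    x                                  ≡⟨ x≡ ⟩
    e * + (7 N.^ j)                    ≡⟨ cong (_* + (7 N.^ j)) e≡7c ⟩
    (+ 0 Z.+ c * + 7) * + (7 N.^ j)    ≡⟨ regroup c (+ 7) (+ (7 N.^ j)) ⟩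
    c * (+ 7 * + (7 N.^ j))            ≡⟨ cong (c *_) (sym (ZP.pos-* 7 (7 N.^ j))) ⟩
    c * + (7 N.^ N.suc j)              ∎)))
    where open ≡-Reasoning

module Scale (m : ℕ) where
  instance
    7^m≢0 : N.NonZero (7 N.^ m)
    7^m≢0 = NP.m^n≢0 7 m

  open Digits (7 N.^ m) {{7^m≢0}} public

  ẽ-hi : ∀ x y → ẽ m x y ≡ mod7 (hi x Z.+ hi x - hi y)
  ẽ-hi x y = sym (trans (mod7-- (hi x Z.+ hi x) (hi y)) (cong (_⊖ mod7 (hi y)) (mod7-+ (hi x) (hi x))))

  record CarryOf (x y D : ℤ) : Set where
    constructor carry-of
    field
      z       : ℤ
      balance : z * + (7 N.^ m) Z.+ + (lo x N.+ lo x) ≡ + (lo D N.+ lo y)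
      ẽ≡      : ẽ m x y ≡ mod7 (hi D Z.+ z)

  ẽ-carry : ∀ x y D → + 2 * x - y ≡ D → CarryOf x y D
  ẽ-carry x y D D≡ = carry-of _ (carry x y D D≡) (trans (ẽ-hi x y) (cong mod7 (split (hi x) (hi y) (hi D))))
    where
    split : ∀ a b c → a Z.+ a - b ≡ c Z.+ (a Z.+ a - b - c)
    split = solve-∀

Λ-linear : ∀ l d d' → + 2 * (l * d) - l * d' ≡ l * (+ 2 * d - d')
Λ-linear = solve-∀

Λ-shift : ∀ m h k {x c} → h ≤ m → x ≡ c * + (7 N.^ h) → Λelt m h k * x ≡ x Z.+ (⟦ k ⟧ * c) * + (7 N.^ m)
Λ-shift m h k {x} {c} h≤m x≡ = begin
  (+ 1 Z.+ K * ⟦ k ⟧) * x                 ≡⟨ distribute K ⟦ k ⟧ x ⟩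
  x Z.+ K * ⟦ k ⟧ * x                     ≡⟨ cong (λ w → x Z.+ K * ⟦ k ⟧ * w) x≡ ⟩
  x Z.+ K * ⟦ k ⟧ * (c * + (7 N.^ h))     ≡⟨ regroup x K ⟦ k ⟧ c (+ (7 N.^ h)) ⟩
  x Z.+ (⟦ k ⟧ * c) * (K * + (7 N.^ h))   ≡⟨ cong (λ w → x Z.+ (⟦ k ⟧ * c) * w) powers ⟩
  x Z.+ (⟦ k ⟧ * c) * + (7 N.^ m)         ∎
  where
  open ≡-Reasoning
  K = + (7 N.^ (m N.∸ h))
  distribute : ∀ K k x → (+ 1 Z.+ K * k) * x ≡ x Z.+ K * k * x
  distribute = solve-∀
  regroup : ∀ x K k c H → x Z.+ K * k * (c * H) ≡ x Z.+ (k * c) * (K * H)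
  regroup = solve-∀
  powers : K * + (7 N.^ h) ≡ + (7 N.^ m)
  powers = trans (sym (ZP.pos-* (7 N.^ (m N.∸ h)) (7 N.^ h)))
    (cong +_ (trans (sym (NP.^-distribˡ-+-* 7 (m N.∸ h) h)) (cong (7 N.^_) (NP.m∸n+n≡m h≤m))))

Λ₁≡1 : ∀ n k → Λelt (N.suc (N.suc n)) 1 k ≈ + 1 mod + 7
Λ₁≡1 n k = congruent (+ (7 N.^ n) * ⟦ k ⟧)
  (cong (Z._+_ (+ 1)) (trans (cong (_* ⟦ k ⟧) (ZP.pos-* 7 (7 N.^ n))) (regroup (+ (7 N.^ n)) ⟦ k ⟧)))
  where
  regroup : ∀ p k → (+ 7 * p) * k ≡ (p * k) * + 7
  regroup = solve-∀

-- Case (i): if ν(2d − d') = j < m, some λ ∈ Λ_j moves q(λ(2d − d')) to the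
-- centre t of a gap of X, and the carry keeps ẽ(λd, λd') within one step of t.
small-valuation : ∀ m X d d' j → j < m → ν≡ (+ 2 * d - d') j → ℓ X ≤ 4 →
  ∃[ h ] (h < m × ∃[ k ] (ẽ m (Λelt m h k * d) (Λelt m h k * d') ∉ X))
small-valuation m X d d' j j<m νD ℓX≤4 = j , j<m , k , near-∉ (proj₂ gap) near
  where
  open Scale m
  D = + 2 * d - d'
  unit : ∃[ e ] (D ≡ e * + (7 N.^ j) × mod7 e ≢ F.zero)
  unit = unit-part D j νD
  e = proj₁ unit
  gap : ∃[ t ] GapAround X t
  gap = gap-of-three X ℓX≤4
  t = proj₁ gap
  choice : ∃[ k ] (hi D Z.+ ⟦ k ⟧ * e ≈ ⟦ t ⟧ mod + 7)
  choice = choose-multiplier (hi D) e t (proj₂ (proj₂ unit))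
  k = proj₁ choice
  x = Λelt m j k * d
  y = Λelt m j k * d'
  λD = D Z.+ (⟦ k ⟧ * e) * + (7 N.^ m)
  λD≡ : + 2 * x - y ≡ λD
  λD≡ = trans (Λ-linear (Λelt m j k) d d') (Λ-shift m j k (NP.<⇒≤ j<m) (proj₁ (proj₂ unit)))
  open CarryOf (ẽ-carry x y λD λD≡)
  q-λD : mod7 (hi D Z.+ ⟦ k ⟧ * e) ≡ t
  q-λD = trans (mod7-cong (proj₂ choice)) (mod7-⟦⟧ t)
  z-carry : Carry z
  z-carry = digit-sum-carry balance (lo<M x) (lo<M x) (lo<M λD) (lo<M y)
  ẽ-value : ẽ m x y ≡ mod7 ((hi D Z.+ ⟦ k ⟧ * e) Z.+ z)
  ẽ-value = trans ẽ≡ (cong (λ w → mod7 (w Z.+ z)) (proj₁ (digits-shift D (⟦ k ⟧ * e))))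
  near : Near t (ẽ m x y)
  near = subst₂ Near q-λD (sym ẽ-value) (carry-step (hi D Z.+ ⟦ k ⟧ * e) z z-carry)

steer-algebra : ∀ d k S β δ γ α g ρ → d ≡ β Z.+ α * (+ 7 * S) → β ≡ δ Z.+ γ * S →
  γ Z.+ k * d ≡ g Z.+ ρ * + 7 → (+ 1 Z.+ S * k) * d ≡ (δ Z.+ g * S) Z.+ (α Z.+ ρ) * (+ 7 * S)
steer-algebra d k S β δ γ α g ρ d≡ β≡ hit = begin
  (+ 1 Z.+ S * k) * d                                      ≡⟨ expand S k d γ ⟩
  d Z.+ S * (γ Z.+ k * d) - S * γ                          ≡⟨ cong (λ w → d Z.+ S * w - S * γ) hit ⟩
  d Z.+ S * (g Z.+ ρ * + 7) - S * γ                        ≡⟨ cong (λ w → w Z.+ S * (g Z.+ ρ * + 7) - S * γ) (trans d≡ (cong (Z._+ α * (+ 7 * S)) β≡)) ⟩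
  ((δ Z.+ γ * S) Z.+ α * (+ 7 * S)) Z.+ S * (g Z.+ ρ * + 7) - S * γ ≡⟨ collect S δ γ α g ρ ⟩
  (δ Z.+ g * S) Z.+ (α Z.+ ρ) * (+ 7 * S)                  ∎
  where
  open ≡-Reasoning
  expand : ∀ S k d γ → (+ 1 Z.+ S * k) * d ≡ d Z.+ S * (γ Z.+ k * d) - S * γ
  expand = solve-∀
  collect : ∀ S δ γ α g ρ →
    ((δ Z.+ γ * S) Z.+ α * (+ 7 * S)) Z.+ S * (g Z.+ ρ * + 7) - S * γ ≡ (δ Z.+ g * S) Z.+ (α Z.+ ρ) * (+ 7 * S)
  collect = solve-∀

Steered : ℕ → ℤ → ℤ₇ → ℤ₇ → Set
Steered m' d g k = ∃[ δ ] (δ < 7 N.^ m' × Scale.lo (N.suc m') (Λelt (N.suc m') 1 k * d) ≡ δ N.+ F.toℕ g N.* 7 N.^ m')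

steer-digit : ∀ m' d g → mod7 d ≢ F.zero → ∃[ k ] Steered m' d g k
steer-digit m' d g d-unit = k , δ , δ<S , proj₂ (digits-unique {a = hi d Z.+ ρ} λd≡ digit<M)
  where
  open Scale (N.suc m')
  S = 7 N.^ m'
  instance
    S≢0 : N.NonZero S
    S≢0 = NP.m^n≢0 7 m'
  δ = lo d ND.% S
  γ = lo d ND./ S
  δ<S : δ < S
  δ<S = ND.m%n<n (lo d) S
  choice : ∃[ k ] (+ γ Z.+ ⟦ k ⟧ * d ≈ ⟦ g ⟧ mod + 7)
  choice = choose-multiplier (+ γ) d g d-unit
  k = proj₁ choice
  open _≈_mod_ (proj₂ choice) renaming (multiple to ρ; equation to hit)
  d≡ : d ≡ + lo d Z.+ hi d * (+ 7 * + S)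
  d≡ = trans (digits d) (cong (λ w → + lo d Z.+ hi d * w) (ZP.pos-* 7 S))
  lo≡ : + lo d ≡ + δ Z.+ + γ * + S
  lo≡ = trans (cong +_ (ND.m≡m%n+[m/n]*n (lo d) S)) (trans (ZP.pos-+ δ (γ N.* S)) (cong (Z._+_ (+ δ)) (ZP.pos-* γ S)))
  λd≡ : Λelt (N.suc m') 1 k * d ≡ + (δ N.+ F.toℕ g N.* S) Z.+ (hi d Z.+ ρ) * + (7 N.^ N.suc m')
  λd≡ = trans (steer-algebra d ⟦ k ⟧ (+ S) (+ lo d) (+ δ) (+ γ) (hi d) ⟦ g ⟧ ρ d≡ lo≡ hit)
    (cong₂ (λ u w → u Z.+ (hi d Z.+ ρ) * w)
      (trans (cong (Z._+_ (+ δ)) (sym (ZP.pos-* (F.toℕ g) S))) (sym (ZP.pos-+ δ (F.toℕ g N.* S))))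
      (sym (ZP.pos-* 7 S)))
  digit<M : δ N.+ F.toℕ g N.* S < 7 N.^ N.suc m'
  digit<M = NP.+-mono-<-≤ δ<S (NP.*-monoˡ-≤ S (NP.≤-pred (FP.toℕ<n g)))

-- When lo D = 0, the carry in ẽ(x, y) is decided by the top digit of lo x
-- (the digit in position m', where m = m' + 1).
module TopDigit (m' : ℕ) where
  open Scale (N.suc m')

  private
    S = 7 N.^ m'

    balance-over-multiple : ∀ {x y D} (c : CarryOf x y D) → lo D ≡ 0 →
      CarryOf.z c * + (7 N.^ N.suc m') Z.+ + (lo x N.+ lo x) ≡ + lo y
    balance-over-multiple {x} {y} c loD≡0 =
      subst (λ l → CarryOf.z c * + (7 N.^ N.suc m') Z.+ + (lo x N.+ lo x) ≡ + (l N.+ lo y)) loD≡0 (CarryOf.balance c)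

  no-carry-below : ∀ x y D → + 2 * x - y ≡ D → lo D ≡ 0 → lo x < S → ẽ (N.suc m') x y ≡ mod7 (hi D)
  no-carry-below x y D D≡ loD≡0 lo-x<S =
    trans ẽ≡ (cong mod7 (trans (cong (Z._+_ (hi D)) z≡0) (ZP.+-identityʳ (hi D))))
    where
    carried = ẽ-carry x y D D≡
    open CarryOf carried
    doubled : lo x N.+ lo x < 7 N.^ N.suc m'
    doubled = NP.<-≤-trans (NP.+-mono-< lo-x<S lo-x<S) (NP.+-monoʳ-≤ S (NP.m≤m+n S (5 N.* S)))
    z≡0 : z ≡ + 0
    z≡0 = no-carry (balance-over-multiple carried loD≡0) (NP.<-≤-trans doubled (NP.m≤n+m _ (lo y))) (NP.<-≤-trans (lo<M y) (NP.m≤n+m _ (lo x N.+ lo x)))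

  borrow-above : ∀ x y D → + 2 * x - y ≡ D → lo D ≡ 0 → 6 N.* S ≤ lo x → ẽ (N.suc m') x y ≡ mod7 (hi D) ⊖ one
  borrow-above x y D D≡ loD≡0 6S≤lo-x =
    trans ẽ≡ (trans (cong (λ w → mod7 (hi D Z.+ w)) z≡-1) (mod7-- (hi D) (+ 1)))
    where
    carried = ẽ-carry x y D D≡
    open CarryOf carried
    7S≤doubled : 7 N.^ N.suc m' ≤ lo x N.+ lo x
    7S≤doubled = NP.≤-trans (NP.*-monoˡ-≤ S (NP.m≤m+n 7 5))
      (NP.≤-trans (NP.≤-reflexive (NP.*-distribʳ-+ S 6 6)) (NP.+-mono-≤ 6S≤lo-x 6S≤lo-x))
    z≡-1 : z ≡ -[1+ 0 ]
    z≡-1 = borrow (balance-over-multiple carried loD≡0) (NP.<-≤-trans (lo<M y) 7S≤doubled) (two-digits< (lo y) (lo<M x) (lo<M x))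

six : ℤ₇
six = F.fromℕ 6

-- Case (ii): if ν(2d − d') = m ≥ 2, then q(λ(2d − d')) = r(2d − d') for every
-- λ ∈ Λ₁, and steering the top digit of lo(λd) to 0 or to 6 makes ẽ(λd, λd')
-- equal to r or to r − 1; one of them lies outside X.
top-valuation : ∀ n X d d' → let m = N.suc (N.suc n) in
  ν≡ d 0 → ν≡ (+ 2 * d - d') m → r (+ 2 * d - d') m ∉ X ∩ (X +1) →
  ∃[ h ] (h < m × ∃[ k ] (ẽ m (Λelt m h k * d) (Λelt m h k * d') ∉ X))
top-valuation n X d d' νd νD r∉ = 1 , N.s≤s (N.s≤s N.z≤n) , avoid (r D m ∈? X)
  where
  m' = N.suc n
  m = N.suc m'
  open Scale m
  open TopDigit m'
  D = + 2 * d - d'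
  λₖ : ℤ₇ → ℤ
  λₖ k = Λelt m 1 k

  unit-D : ∃[ e ] (D ≡ e * + (7 N.^ m) × mod7 e ≢ F.zero)
  unit-D = unit-part D m νD
  e = proj₁ unit-D
  unit-d : ∃[ e₀ ] (d ≡ e₀ * + 1 × mod7 e₀ ≢ F.zero)
  unit-d = unit-part d 0 νd
  d-unit : mod7 d ≢ F.zero
  d-unit d≡0 = proj₂ (proj₂ unit-d)
    (trans (cong mod7 (sym (trans (proj₁ (proj₂ unit-d)) (ZP.*-identityʳ (proj₁ unit-d))))) d≡0)

  scaled-digits : ∀ l → hi (l * D) ≡ l * e × lo (l * D) ≡ 0
  scaled-digits l = digits-unique {a = l * e} (trans (cong (l *_) (proj₁ (proj₂ unit-D))) (regroup l e (+ (7 N.^ m))))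
    (NP.m^n>0 7 m)
    where
    regroup : ∀ l e M → l * (e * M) ≡ + 0 Z.+ (l * e) * M
    regroup = solve-∀

  hi-D : hi D ≡ e
  hi-D = trans (cong hi (sym (ZP.*-identityˡ D))) (trans (proj₁ (scaled-digits (+ 1))) (ZP.*-identityˡ e))

  -- q(λD) = r(D), since λ ≡ 1 modulo 7.
  q-λD : ∀ k → mod7 (hi (λₖ k * D)) ≡ r D m
  q-λD k = begin
    mod7 (hi (λₖ k * D))  ≡⟨ cong mod7 (proj₁ (scaled-digits (λₖ k))) ⟩
    mod7 (λₖ k * e)       ≡⟨ mod7-cong (≈-* (Λ₁≡1 n k) ≈-refl) ⟩
    mod7 (+ 1 * e)        ≡⟨ cong mod7 (trans (ZP.*-identityˡ e) (sym hi-D)) ⟩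
    r D m                 ∎
    where open ≡-Reasoning

  ẽ-digit-0 : ∀ k → Steered m' d F.zero k → ẽ m (λₖ k * d) (λₖ k * d') ≡ r D m
  ẽ-digit-0 k (δ , δ<S , lo≡) = trans
    (no-carry-below (λₖ k * d) (λₖ k * d') (λₖ k * D) (Λ-linear (λₖ k) d d') (proj₂ (scaled-digits (λₖ k))) lo<S)
    (q-λD k)
    where
    lo<S : lo (λₖ k * d) < 7 N.^ m'
    lo<S = subst (_< 7 N.^ m') (sym (trans lo≡ (NP.+-identityʳ δ))) δ<S

  ẽ-digit-6 : ∀ k → Steered m' d six k → ẽ m (λₖ k * d) (λₖ k * d') ≡ r D m ⊖ one
  ẽ-digit-6 k (δ , _ , lo≡) = trans
    (borrow-above (λₖ k * d) (λₖ k * d') (λₖ k * D) (Λ-linear (λₖ k) d d') (proj₂ (scaled-digits (λₖ k))) 6S≤lo)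
    (cong (_⊖ one) (q-λD k))
    where
    6S≤lo : 6 N.* 7 N.^ m' ≤ lo (λₖ k * d)
    6S≤lo = subst (6 N.* 7 N.^ m' ≤_) (sym lo≡) (NP.m≤n+m (6 N.* 7 N.^ m') δ)

  avoid : Dec (r D m ∈ X) → ∃[ k ] (ẽ m (λₖ k * d) (λₖ k * d') ∉ X)
  avoid (no r∉X) = let (k , steered) = steer-digit m' d F.zero d-unit in
    k , subst (_∉ X) (sym (ẽ-digit-0 k steered)) r∉X
  avoid (yes r∈X) = let (k , steered) = steer-digit m' d six d-unit in
    k , subst (_∉ X) (sym (ẽ-digit-6 k steered)) (predecessor-∉ r∉ r∈X)

-- The theorem: case (i) or case (ii) (the latter needs m ≥ 2 so that Λ₁ ≡ 1
-- modulo 7).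
lemma5 : (m : ℕ) → 2 ≤ m → (X : Subset 7) → (d d' : ℤ) →
    ν≡ d 0 → ν≡ d' 0 → r d' 0 ≡ two· (r d 0) →
    ((∃[ k ] (k < m × ν≡ (+ 2 * d - d') k)) × ℓ X ≤ 4)
      ⊎ (ν≡ (+ 2 * d - d') m × r (+ 2 * d - d') m ∉ (X ∩ (X +1))) →
    ∃[ h ] (h < m × ∃[ k ] (ẽ m (Λelt m h k * d) (Λelt m h k * d') ∉ X))
lemma5 m _ X d d' _ _ _ (inj₁ ((j , j<m , νD) , ℓX≤4)) = small-valuation m X d d' j j<m νD ℓX≤4
lemma5 (N.suc (N.suc n)) _ X d d' νd _ _ (inj₂ (νD , r∉)) = top-valuation n X d d' νd νD r∉
lemma5 (N.suc N.zero) (N.s≤s ()) _ _ _ _ _ _ (inj₂ _)
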